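{- Let $\Gamma \cup \{\phi\} \subseteq \mathcal{L}_{\Box\Diamond}$ be a set of formulas. Then $\Gamma \vdash_{\mathsf{IM}} \phi$ implies $\Gamma^t \vdash_{\mathsf{IK}_2} \phi^t$.
   Context: $\mathcal{L}_{\Box\Diamond}$ is the language $\phi ::= p_i \mid \bot \mid \phi\wedge\phi \mid \phi\vee\phi \mid \phi\to\phi \mid \Box\phi \mid \Diamond\phi$. $\mathsf{IM}$ is the logic (set of consecutions) axiomatised by intuitionistic logic plus $(\Box p\wedge\Diamond\neg p)\to\bot$ and $(\Box\top\to\Diamond p)\to\Diamond p$ with the element rule, axiom rule, modus ponens and the monotonicity rules (from $\emptyset\vdash\phi\to\psi$ infer $\Gamma\vdash\Box\phi\to\Box\psi$ and $\Gamma\vdash\Diamond\phi\to\Diamond\psi$). $\mathsf{IK}_2$ is the bimodal version (modalities $\Box_N,\Diamond_N,\Box_{\ni},\Diamond_{\ni}$) of the intuitionistic modal logic $\mathsf{IK}$: intuitionistic logic plus, for each index $j$, $\Box_j(p\to q)\to(\Box_jp\to\Box_jq)$, $\Box_j(p\to q)\to(\Diamond_jp\to\Diamond_jq)$, $\neg\Diamond_j\bot$, $\Diamond_j(p\vee q)\to(\Diamond_jp\vee\Diamond_jq)$, $(\Diamond_jp\to\Box_jq)\to\Box_j(p\to q)$, with modus ponens and necessitation (from $\emptyset\vdash\phi$ infer $\Gamma\vdash\Box_j\phi$). The translation $(-)^t$ fixes propositional letters and $\bot$, commutes with $\wedge,\vee,\to$, and sets $(\Box\phi)^t = \Diamond_N\Box_{\ni}\phi^t$,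 $(\Diamond\phi)^t = \Box_N\Diamond_{\ni}\phi^t$; $\Gamma^t = \{\psi^t \mid \psi\in\Gamma\}$. -}

module Defs where

open import Data.Nat using (ℕ)
open import Data.Product using (Σ; _×_; _,_)
open import Relation.Binary.PropositionalEquality using (_≡_)

infixr 5 _⇒_
infixl 7 _∧_
infixl 6 _∨_

data Form : Set where
  var  : ℕ → Form
  ⊥'   : Form
  _∧_  : Form → Form → Form
  _∨_  : Form → Form → Form
  _⇒_  : Form → Form → Form
  □    : Form → Form
  ◇    : Form → Form

⊤' : Form
⊤' = ⊥' ⇒ ⊥'

¬' : Form → Form
¬' φ = φ ⇒ ⊥'

FSet : Set₁
FSet = Form → Set

∅ : FSet
∅ _ = Data.Empty.⊥ where import Data.Empty

data AxIM : Form → Set where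
  k    : ∀ φ ψ → AxIM (φ ⇒ ψ ⇒ φ)
  s    : ∀ φ ψ χ → AxIM ((φ ⇒ ψ ⇒ χ) ⇒ (φ ⇒ ψ) ⇒ φ ⇒ χ)
  ∧e₁  : ∀ φ ψ → AxIM (φ ∧ ψ ⇒ φ)
  ∧e₂  : ∀ φ ψ → AxIM (φ ∧ ψ ⇒ ψ)
  ∧i   : ∀ φ ψ → AxIM (φ ⇒ ψ ⇒ φ ∧ ψ)
  ∨i₁  : ∀ φ ψ → AxIM (φ ⇒ φ ∨ ψ)
  ∨i₂  : ∀ φ ψ → AxIM (ψ ⇒ φ ∨ ψ)
  ∨e   : ∀ φ ψ χ → AxIM ((φ ⇒ χ) ⇒ (ψ ⇒ χ) ⇒ φ ∨ ψ ⇒ χ)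
  efq  : ∀ φ → AxIM (⊥' ⇒ φ)
  □◇¬  : ∀ φ → AxIM (□ φ ∧ ◇ (¬' φ) ⇒ ⊥')
  □⊤◇  : ∀ φ → AxIM ((□ ⊤' ⇒ ◇ φ) ⇒ ◇ φ)

infix 3 _⊢IM_
data _⊢IM_ (Γ : FSet) : Form → Set₁ where
  elem  : ∀ {φ} → Γ φ → Γ ⊢IM φ
  ax    : ∀ {φ} → AxIM φ → Γ ⊢IM φ
  mp    : ∀ {φ ψ} → Γ ⊢IM φ → Γ ⊢IM φ ⇒ ψ → Γ ⊢IM ψ
  mon□  : ∀ {φ ψ} → ∅ ⊢IM φ ⇒ ψ → Γ ⊢IM □ φ ⇒ □ ψ
  mon◇  : ∀ {φ ψ} → ∅ ⊢IM φ ⇒ ψ → Γ ⊢IM ◇ φ ⇒ ◇ ψ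

data Idx : Set where
  N  : Idx
  ∋' : Idx

infixr 5 _⇒₂_
infixl 7 _∧₂_
infixl 6 _∨₂_

data Form₂ : Set where
  var₂  : ℕ → Form₂
  ⊥₂    : Form₂
  _∧₂_  : Form₂ → Form₂ → Form₂
  _∨₂_  : Form₂ → Form₂ → Form₂
  _⇒₂_  : Form₂ → Form₂ → Form₂
  □₂    : Idx → Form₂ → Form₂
  ◇₂    : Idx → Form₂ → Form₂

¬₂ : Form₂ → Form₂
¬₂ φ = φ ⇒₂ ⊥₂

FSet₂ : Set₁
FSet₂ = Form₂ → Set

∅₂ : FSet₂
∅₂ _ = Data.Empty.⊥ where import Data.Empty

data AxIK₂ : Form₂ → Set where
  k    : ∀ φ ψ → AxIK₂ (φ ⇒₂ ψ ⇒₂ φ)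
  s    : ∀ φ ψ χ → AxIK₂ ((φ ⇒₂ ψ ⇒₂ χ) ⇒₂ (φ ⇒₂ ψ) ⇒₂ φ ⇒₂ χ)
  ∧e₁  : ∀ φ ψ → AxIK₂ (φ ∧₂ ψ ⇒₂ φ)
  ∧e₂  : ∀ φ ψ → AxIK₂ (φ ∧₂ ψ ⇒₂ ψ)
  ∧i   : ∀ φ ψ → AxIK₂ (φ ⇒₂ ψ ⇒₂ φ ∧₂ ψ)
  ∨i₁  : ∀ φ ψ → AxIK₂ (φ ⇒₂ φ ∨₂ ψ)
  ∨i₂  : ∀ φ ψ → AxIK₂ (ψ ⇒₂ φ ∨₂ ψ)
  ∨e   : ∀ φ ψ χ → AxIK₂ ((φ ⇒₂ χ) ⇒₂ (ψ ⇒₂ χ) ⇒₂ φ ∨₂ ψ ⇒₂ χ)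
  efq  : ∀ φ → AxIK₂ (⊥₂ ⇒₂ φ)
  K□   : ∀ j φ ψ → AxIK₂ (□₂ j (φ ⇒₂ ψ) ⇒₂ □₂ j φ ⇒₂ □₂ j ψ)
  K◇   : ∀ j φ ψ → AxIK₂ (□₂ j (φ ⇒₂ ψ) ⇒₂ ◇₂ j φ ⇒₂ ◇₂ j ψ)
  N◇   : ∀ j → AxIK₂ (¬₂ (◇₂ j ⊥₂))
  ◇∨   : ∀ j φ ψ → AxIK₂ (◇₂ j (φ ∨₂ ψ) ⇒₂ ◇₂ j φ ∨₂ ◇₂ j ψ)
  FS   : ∀ j φ ψ → AxIK₂ ((◇₂ j φ ⇒₂ □₂ j ψ) ⇒₂ □₂ j (φ ⇒₂ ψ))

infix 3 _⊢IK₂_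
data _⊢IK₂_ (Γ : FSet₂) : Form₂ → Set₁ where
  elem  : ∀ {φ} → Γ φ → Γ ⊢IK₂ φ
  ax    : ∀ {φ} → AxIK₂ φ → Γ ⊢IK₂ φ
  mp    : ∀ {φ ψ} → Γ ⊢IK₂ φ → Γ ⊢IK₂ φ ⇒₂ ψ → Γ ⊢IK₂ ψ
  nec   : ∀ {φ} j → ∅₂ ⊢IK₂ φ → Γ ⊢IK₂ □₂ j φ

_ᵗ : Form → Form₂
var i ᵗ   = var₂ i
⊥' ᵗ      = ⊥₂
(φ ∧ ψ) ᵗ = φ ᵗ ∧₂ ψ ᵗ
(φ ∨ ψ) ᵗ = φ ᵗ ∨₂ ψ ᵗ
(φ ⇒ ψ) ᵗ = φ ᵗ ⇒₂ ψ ᵗ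
□ φ ᵗ     = ◇₂ N (□₂ ∋' (φ ᵗ))
◇ φ ᵗ     = □₂ N (◇₂ ∋' (φ ᵗ))

_ᵗˢ : FSet → FSet₂
(Γ ᵗˢ) χ = Σ Form (λ ψ → Γ ψ × (ψ ᵗ ≡ χ))

{-# OPTIONS --safe #-}
module Submission where

-- The translation reads □φ as "some N-neighbourhood all of whose ∋-points satisfy φ",
-- and ◇φ as "every N-neighbourhood has a ∋-point satisfying φ".  The
-- propositional part is translated verbatim, and the monotonicity rules of IM
-- become necessitation plus K for each of the two nested modalities.  The axiom
-- (□p ∧ ◇¬p) → ⊥ holds because, in the N-neighbourhood witnessing □p, □∋A clashes
-- with ◇∋¬A (K◇ and ¬◇⊥ for ∋, then again for N); the axiom (□⊤ → ◇p) → ◇p is the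
-- Fischer Servi axiom for N with its ◇-premise □∋⊤ discharged by necessitation.

open import Defs
open import Data.Sum using (_⊎_; inj₁; inj₂)
open import Data.Product using (_,_)
open import Relation.Binary.PropositionalEquality using (_≡_; refl)

infixl 4 _,,_
infixl 5 _·_

_,,_ : FSet₂ → Form₂ → FSet₂
(Γ ,, A) χ = χ ≡ A ⊎ Γ χ

variable
  Γ Δ : FSet₂
  A B C : Form₂

_·_ : Γ ⊢IK₂ A ⇒₂ B → Γ ⊢IK₂ A → Γ ⊢IK₂ B
p · q = mp q p

⊢-mono : (∀ {χ} → Γ χ → Δ χ) → Γ ⊢IK₂ A → Δ ⊢IK₂ A
⊢-mono Γ⊆Δ (elem g)  = elem (Γ⊆Δ g)
⊢-mono Γ⊆Δ (ax a)    = ax a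
⊢-mono Γ⊆Δ (mp p q)  = mp (⊢-mono Γ⊆Δ p) (⊢-mono Γ⊆Δ q)
⊢-mono Γ⊆Δ (nec j p) = nec j p

∅₂⊢⇒⊢ : ∅₂ ⊢IK₂ A → Γ ⊢IK₂ A
∅₂⊢⇒⊢ = ⊢-mono λ ()

hyp : Γ ,, A ⊢IK₂ A
hyp = elem (inj₁ refl)

weaken : Γ ⊢IK₂ A → Γ ,, B ⊢IK₂ A
weaken = ⊢-mono inj₂

⇒-refl : Γ ⊢IK₂ A ⇒₂ A
⇒-refl {A = A} = ax (s A (A ⇒₂ A) A) · ax (k A (A ⇒₂ A)) · ax (k A A)

deduction : Γ ,, A ⊢IK₂ B → Γ ⊢IK₂ A ⇒₂ B
deduction (elem (inj₁ refl)) = ⇒-refl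
deduction (elem (inj₂ g))    = ax (k _ _) · elem g
deduction (ax a)             = ax (k _ _) · ax a
deduction (mp p q)           = ax (s _ _ _) · deduction q · deduction p
deduction (nec j p)          = ax (k _ _) · nec j p

⇒-flip : Γ ⊢IK₂ A ⇒₂ B ⇒₂ C → Γ ⊢IK₂ B ⇒₂ A ⇒₂ C
⇒-flip p = deduction (deduction (weaken (weaken p) · hyp · weaken hyp))

□-mono : ∀ j → ∅₂ ⊢IK₂ A ⇒₂ B → Γ ⊢IK₂ □₂ j A ⇒₂ □₂ j B
□-mono j p = ax (K□ j _ _) · nec j p

◇-mono : ∀ j → ∅₂ ⊢IK₂ A ⇒₂ B → Γ ⊢IK₂ ◇₂ j A ⇒₂ ◇₂ j B
◇-mono j p = ax (K◇ j _ _) · nec j p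

□-◇-clash : ∀ j → ∅₂ ⊢IK₂ B ⇒₂ ¬₂ A → Γ ⊢IK₂ □₂ j B ⇒₂ ¬₂ (◇₂ j A)
□-◇-clash j p = deduction (deduction
  (ax (N◇ j) · (ax (K◇ j _ _) · (□-mono j p · weaken hyp) · hyp)))

◇□-contradicts-□◇¬ : Γ ⊢IK₂ ◇₂ N (□₂ ∋' A) ⇒₂ ¬₂ (□₂ N (◇₂ ∋' (¬₂ A)))
◇□-contradicts-□◇¬ = ⇒-flip (□-◇-clash N (⇒-flip (□-◇-clash ∋' (⇒-flip ⇒-refl))))

□-discharge-◇ : ∀ j → ∅₂ ⊢IK₂ A → Γ ⊢IK₂ (◇₂ j A ⇒₂ □₂ j B) ⇒₂ □₂ j B
□-discharge-◇ j p = deduction (ax (K□ j _ _) · (ax (FS j _ _) · hyp) · nec j p)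

translate-axiom : ∀ {φ} → AxIM φ → ∅₂ ⊢IK₂ φ ᵗ
translate-axiom (k φ ψ)     = ax (k _ _)
translate-axiom (s φ ψ χ)   = ax (s _ _ _)
translate-axiom (∧e₁ φ ψ)   = ax (∧e₁ _ _)
translate-axiom (∧e₂ φ ψ)   = ax (∧e₂ _ _)
translate-axiom (∧i φ ψ)    = ax (∧i _ _)
translate-axiom (∨i₁ φ ψ)   = ax (∨i₁ _ _)
translate-axiom (∨i₂ φ ψ)   = ax (∨i₂ _ _)
translate-axiom (∨e φ ψ χ)  = ax (∨e _ _ _)
translate-axiom (efq φ)     = ax (efq _)
translate-axiom (□◇¬ φ)     =
  deduction (◇□-contradicts-□◇¬ · (ax (∧e₁ _ _) · hyp) · (ax (∧e₂ _ _) · hyp))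
translate-axiom (□⊤◇ φ)     = □-discharge-◇ N (nec ∋' ⇒-refl)

∅ᵗˢ⊆∅₂ : ∀ {χ} → (∅ ᵗˢ) χ → ∅₂ χ
∅ᵗˢ⊆∅₂ (_ , () , _)

proposition4p15 : (Γ : FSet) (φ : Form) → Γ ⊢IM φ → (Γ ᵗˢ) ⊢IK₂ (φ ᵗ)
proposition4p15 Γ φ (elem g)  = elem (φ , g , refl)
proposition4p15 Γ φ (ax a)    = ∅₂⊢⇒⊢ (translate-axiom a)
proposition4p15 Γ φ (mp p q)  = proposition4p15 Γ _ q · proposition4p15 Γ _ p
proposition4p15 Γ _ (mon□ p)  =
  ◇-mono N (□-mono ∋' (⊢-mono ∅ᵗˢ⊆∅₂ (proposition4p15 ∅ _ p)))
proposition4p15 Γ _ (mon◇ p)  =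
  □-mono N (◇-mono ∋' (⊢-mono ∅ᵗˢ⊆∅₂ (proposition4p15 ∅ _ p)))
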